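{- If $A\subseteq X_n$, then for any $i$ and any $j$ we have $|\pi_j(\mathcal{C}_i(A))|\leq|\pi_j(A)|$.
   Context: $X_n=\{x\in\mathbb{Z}_{\ge0}^n: x_k=0\text{ for some } k\}$; $\pi_j$ deletes the $j$-th coordinate. For $A\subseteq\mathbb{Z}_{\ge0}^n$ the complete $i$-compression is $\mathcal{C}_i(A)=\{(x_1,\dots,x_{i-1},a,x_{i+1},\dots,x_n): a\in\mathbb{Z}_{\ge0}$ and there are at least $a+1$ elements $y\in A$ with $y_k=x_k$ for all $k\neq i\}$. -}

module Defs where

open import Data.Nat using (ℕ; suc; _≤_)
import Data.Nat as ℕ
open import Data.Fin using (Fin)
open import Data.Vec using (Vec; lookup; removeAt)
open import Data.Vec.Properties using (≡-dec)
open import Data.List using (List; length; filter; deduplicate; map)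
open import Data.Product using (∃)
open import Relation.Binary.PropositionalEquality using (_≡_)
open import Relation.Nullary using (Dec)

Point : ℕ → Set
Point n = Vec ℕ n

_≟ᵥ_ : ∀ {n} (x y : Point n) → Dec (x ≡ y)
_≟ᵥ_ = ≡-dec ℕ._≟_

-- A finite set of points is given by a list (duplicates irrelevant);
-- its cardinality is the number of distinct entries.
card : ∀ {n} → List (Point n) → ℕ
card L = length (deduplicate _≟ᵥ_ L)

InX : ∀ {n} → Point n → Set
InX {n} x = ∃ λ (k : Fin n) → lookup x k ≡ 0

π : ∀ {m} → Fin (suc m) → Point (suc m) → Point m
π j x = removeAt x j

fibreCount : ∀ {m} → List (Point (suc m)) → Fin (suc m) → Point (suc m) → ℕ
fibreCount A i x = length (filter (λ y → π i y ≟ᵥ π i x) (deduplicate _≟ᵥ_ A))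

InC : ∀ {m} → Fin (suc m) → List (Point (suc m)) → Point (suc m) → Set
InC i A x = suc (lookup x i) ≤ fibreCount A i x

-- Work in one (i,j)-plane, i.e. among points agreeing off the coordinates i and j.
-- Inside it C_i(A) replaces every i-line of A by an initial segment of the same size, so
-- the i-coordinates occurring in C_i(A) there are 0, …, M−1, where M is the size of the
-- longest i-line of A in the plane. Sending x ∈ C_i(A) to the (x_i+1)-th point of that
-- longest line maps C_i(A) into A, and π_j of the image still determines π_j x;
-- so π_j(C_i(A)) is no larger than π_j(A).
module Submission where

open import Defs
open import Data.Nat using (ℕ; suc; zero; _≤_; _<_; z≤n; s≤s)
open import Data.Nat.Properties using (≤-trans; <-≤-trans; module ≤-Reasoning)
open import Data.Fin using (Fin; punchOut; punchIn) renaming (_≟_ to _≟ᶠ_)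
open import Data.Fin.Properties using (punchInᵢ≢i; punchOut-punchIn)
open import Data.Vec using (lookup; removeAt; _[_]≔_)
open import Data.Vec.Properties
  using (removeAt-punchOut; lookup∘update; lookup∘update′; tabulate∘lookup; tabulate-cong)
open import Data.List using (List; []; _∷_; map; filter; length; deduplicate)
open import Data.List.Properties using (filter-all; filter-notAll; length-filter)
open import Data.List.Extrema.Nat using (argmax; f[xs]≤f[argmax]; argmax-all)
open import Data.List.Relation.Unary.All as All using (All; _∷_)
open import Data.List.Relation.Unary.Any as Any using (here; there)
open import Data.List.Relation.Unary.Unique.Propositional using (Unique; _∷_)
open import Data.List.Relation.Unary.Unique.Propositional.Properties using (filter⁺)
open import Data.List.Relation.Unary.Unique.DecPropositional.Properties using (deduplicate-!)
open import Data.List.Relation.Binary.Subset.Propositional using (_⊆_)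
open import Data.List.Relation.Binary.Subset.Propositional.Properties using (∈-∷⁺ʳ; xs⊆x∷xs; ⊆-refl)
open import Data.List.Membership.Propositional using (_∈_; _∉_)
open import Data.List.Membership.Propositional.Properties
  using (∈-filter⁺; ∈-filter⁻; ∈-map⁺; ∈-map⁻; ∈-deduplicate⁺; ∈-deduplicate⁻)
open import Data.Product using (∃; _×_; _,_; proj₁; proj₂)
open import Data.Empty using (⊥-elim)
open import Function using (_∘_)
open import Function.Bundles using (_⇔_; Equivalence)
open import Relation.Nullary using (¬?; yes; no)
open import Relation.Binary.Definitions using (DecidableEquality)
open import Relation.Binary.PropositionalEquality
  using (_≡_; _≢_; refl; sym; trans; cong; subst; module ≡-Reasoning)

module _ {a} {X : Set a} where

  ∈-of-nonempty : ∀ {xs : List X} → 0 < length xs → ∃ (_∈ xs)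
  ∈-of-nonempty {x ∷ _} _ = x , here refl

  nthOr : X → List X → ℕ → X
  nthOr d []       _       = d
  nthOr d (x ∷ xs) zero    = x
  nthOr d (x ∷ xs) (suc k) = nthOr d xs k

  nthOr-∈ : ∀ d (xs : List X) {k} → k < length xs → nthOr d xs k ∈ xs
  nthOr-∈ d (x ∷ xs) {zero}  _         = here refl
  nthOr-∈ d (x ∷ xs) {suc k} (s≤s k<n) = there (nthOr-∈ d xs k<n)

  nthOr-injective : ∀ {d e} {xs : List X} {k l} → Unique xs → k < length xs → l < length xs →
                    nthOr d xs k ≡ nthOr e xs l → k ≡ l
  nthOr-injective {xs = x ∷ xs} {zero}  {zero}  _ _ _ _ = refl
  nthOr-injective {e = e} {x ∷ xs} {zero}  {suc l} (x∉ ∷ _) _ (s≤s l<n) x≡ =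
    ⊥-elim (All.lookup x∉ (nthOr-∈ e xs l<n) x≡)
  nthOr-injective {d = d} {xs = x ∷ xs} {suc k} {zero} (x∉ ∷ _) (s≤s k<n) _ ≡x =
    ⊥-elim (All.lookup x∉ (nthOr-∈ d xs k<n) (sym ≡x))
  nthOr-injective {xs = x ∷ xs} {suc k} {suc l} (_ ∷ !xs) (s≤s k<n) (s≤s l<n) eq =
    cong suc (nthOr-injective !xs k<n l<n eq)

module _ {a} {X : Set a} (_≟_ : DecidableEquality X) where

  Unique-⊆⇒length-≤ : ∀ {xs ys : List X} → Unique xs → Unique ys → xs ⊆ ys → length xs ≤ length ys
  Unique-⊆⇒length-≤ {[]} _ _ _ = z≤n
  Unique-⊆⇒length-≤ {x ∷ xs} {ys} (x∉xs ∷ !xs) !ys x∷xs⊆ys =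
    <-≤-trans (s≤s (Unique-⊆⇒length-≤ !xs (filter⁺ ≢x? !ys) xs⊆ys-x))
              (filter-notAll ≢x? ys (Any.map (λ x≡ x≢ → x≢ x≡) (x∷xs⊆ys (here refl))))
    where
    ≢x? = λ z → ¬? (x ≟ z)
    xs⊆ys-x : xs ⊆ filter ≢x? ys
    xs⊆ys-x z∈ = ∈-filter⁺ ≢x? (x∷xs⊆ys (there z∈)) (All.lookup x∉xs z∈)

module _ {n : ℕ} where

  card-mono : ∀ {X Y : List (Point n)} → X ⊆ Y → card X ≤ card Y
  card-mono {X} {Y} X⊆Y =
    Unique-⊆⇒length-≤ _≟ᵥ_ (deduplicate-! _≟ᵥ_ X) (deduplicate-! _≟ᵥ_ Y)
      (∈-deduplicate⁺ _≟ᵥ_ ∘ X⊆Y ∘ ∈-deduplicate⁻ _≟ᵥ_ X)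

  card-∷-≤ : ∀ z (X : List (Point n)) → card (z ∷ X) ≤ suc (card X)
  card-∷-≤ z X = s≤s (length-filter (λ y → ¬? (z ≟ᵥ y)) (deduplicate _≟ᵥ_ X))

  card-∷-∉ : ∀ z (X : List (Point n)) → z ∉ X → card (z ∷ X) ≡ suc (card X)
  card-∷-∉ z X z∉X = cong suc (cong length (filter-all (λ y → ¬? (z ≟ᵥ y))
    (All.tabulate λ y∈ z≡y → z∉X (subst (_∈ X) (sym z≡y) (∈-deduplicate⁻ _≟ᵥ_ X y∈)))))

  card-map-coarsen : ∀ {a} {X : Set a} (h f : X → Point n) (L : List X) →
                     (∀ {x y} → x ∈ L → y ∈ L → f x ≡ f y → h x ≡ h y) →
                     card (map h L) ≤ card (map f L)
  card-map-coarsen h f []      _      = z≤n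
  card-map-coarsen h f (x ∷ L) coarse with Any.any? (f x ≟ᵥ_) (map f L)
  ... | yes fx∈ =
    let y , y∈ , fx≡fy = ∈-map⁻ f fx∈
        hx∈ = subst (_∈ map h L) (sym (coarse (here refl) (there y∈) fx≡fy)) (∈-map⁺ h y∈)
    in begin
      card (h x ∷ map h L)   ≤⟨ card-mono (∈-∷⁺ʳ hx∈ ⊆-refl) ⟩
      card (map h L)         ≤⟨ card-map-coarsen h f L (λ x∈ y∈ → coarse (there x∈) (there y∈)) ⟩
      card (map f L)         ≤⟨ card-mono {map f L} (xs⊆x∷xs _ (f x)) ⟩
      card (f x ∷ map f L)   ∎
    where open ≤-Reasoning
  ... | no fx∉ = begin
      card (h x ∷ map h L)   ≤⟨ card-∷-≤ (h x) (map h L) ⟩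
      suc (card (map h L))   ≤⟨ s≤s (card-map-coarsen h f L (λ x∈ y∈ → coarse (there x∈) (there y∈))) ⟩
      suc (card (map f L))   ≡⟨ sym (card-∷-∉ (f x) (map f L) fx∉) ⟩
      card (f x ∷ map f L)   ∎
    where open ≤-Reasoning

lookup-ext : ∀ {n} {u v : Point n} → (∀ k → lookup u k ≡ lookup v k) → u ≡ v
lookup-ext {u = u} {v} eq =
  trans (sym (tabulate∘lookup u)) (trans (tabulate-cong eq) (tabulate∘lookup v))

module _ {m : ℕ} (i : Fin (suc m)) (u v : Point (suc m)) where

  π-≡⇒lookup-≡ : π i u ≡ π i v → ∀ {k} → k ≢ i → lookup u k ≡ lookup v k
  π-≡⇒lookup-≡ πu≡πv {k} k≢i = begin
    lookup u k                              ≡⟨ sym (removeAt-punchOut u i≢k) ⟩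
    lookup (removeAt u i) (punchOut i≢k)    ≡⟨ cong (λ w → lookup w (punchOut i≢k)) πu≡πv ⟩
    lookup (removeAt v i) (punchOut i≢k)    ≡⟨ removeAt-punchOut v i≢k ⟩
    lookup v k                              ∎
    where
    open ≡-Reasoning
    i≢k = k≢i ∘ sym

  lookup-≡⇒π-≡ : (∀ {k} → k ≢ i → lookup u k ≡ lookup v k) → π i u ≡ π i v
  lookup-≡⇒π-≡ agree = lookup-ext λ k → begin
    lookup (removeAt u i) k   ≡⟨ lookup-removeAt u k ⟩
    lookup u (punchIn i k)    ≡⟨ agree (punchInᵢ≢i i k) ⟩
    lookup v (punchIn i k)    ≡⟨ sym (lookup-removeAt v k) ⟩
    lookup (removeAt v i) k   ∎
    where
    open ≡-Reasoning
    lookup-removeAt : ∀ w k → lookup (removeAt w i) k ≡ lookup w (punchIn i k)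
    lookup-removeAt w k = subst (λ l → lookup (removeAt w i) l ≡ lookup w (punchIn i k))
      (punchOut-punchIn i) (removeAt-punchOut w (punchInᵢ≢i i k ∘ sym))

π-≡∧π-≡⇒≡ : ∀ {m} {i j : Fin (suc m)} (u v : Point (suc m)) → i ≢ j →
            π i u ≡ π i v → π j u ≡ π j v → u ≡ v
π-≡∧π-≡⇒≡ {i = i} {j} u v i≢j πᵢ πⱼ = lookup-ext agree
  where
  agree : ∀ k → lookup u k ≡ lookup v k
  agree k with k ≟ᶠ i
  ... | yes refl = π-≡⇒lookup-≡ j u v πⱼ i≢j
  ... | no k≢i   = π-≡⇒lookup-≡ i u v πᵢ k≢i

-- The (i,j)-plane through u, represented by its point with u_i = u_j = 0.
plane : ∀ {n} → Fin n → Fin n → Point n → Point n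
plane i j u = (u [ i ]≔ 0) [ j ]≔ 0

module _ {n} {i j : Fin n} where

  lookup-plane : ∀ u {k} → k ≢ i → k ≢ j → lookup (plane i j u) k ≡ lookup u k
  lookup-plane u k≢i k≢j = trans (lookup∘update′ k≢j (u [ i ]≔ 0) 0) (lookup∘update′ k≢i u 0)

  lookup-plane-i : ∀ u → lookup (plane i j u) i ≡ 0
  lookup-plane-i u with i ≟ᶠ j
  ... | yes refl = lookup∘update i (u [ i ]≔ 0) 0
  ... | no i≢j   = trans (lookup∘update′ i≢j (u [ i ]≔ 0) 0) (lookup∘update i u 0)

  lookup-plane-j : ∀ u → lookup (plane i j u) j ≡ 0
  lookup-plane-j u = lookup∘update j (u [ i ]≔ 0) 0

  plane-≡⇒lookup-≡ : ∀ u v → plane i j u ≡ plane i j v → ∀ {k} → k ≢ i → k ≢ j → lookup u k ≡ lookup v k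
  plane-≡⇒lookup-≡ u v eq {k} k≢i k≢j = begin
    lookup u k               ≡⟨ sym (lookup-plane u k≢i k≢j) ⟩
    lookup (plane i j u) k   ≡⟨ cong (λ w → lookup w k) eq ⟩
    lookup (plane i j v) k   ≡⟨ lookup-plane v k≢i k≢j ⟩
    lookup v k               ∎
    where open ≡-Reasoning

  lookup-≡⇒plane-≡ : ∀ u v → (∀ {k} → k ≢ i → k ≢ j → lookup u k ≡ lookup v k) → plane i j u ≡ plane i j v
  lookup-≡⇒plane-≡ u v agree = lookup-ext pointwise
    where
    pointwise : ∀ k → lookup (plane i j u) k ≡ lookup (plane i j v) k
    pointwise k with k ≟ᶠ i | k ≟ᶠ j
    ... | yes refl | _        = trans (lookup-plane-i u) (sym (lookup-plane-i v))
    ... | no _     | yes refl = trans (lookup-plane-j u) (sym (lookup-plane-j v))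
    ... | no k≢i   | no k≢j   = trans (lookup-plane u k≢i k≢j)
                                  (trans (agree k≢i k≢j) (sym (lookup-plane v k≢i k≢j)))

  plane-idem : ∀ u → plane i j (plane i j u) ≡ plane i j u
  plane-idem u = lookup-≡⇒plane-≡ (plane i j u) u (lookup-plane u)

module _ {m} {i j : Fin (suc m)} (u v : Point (suc m)) where

  πᵢ-≡⇒plane-≡ : π i u ≡ π i v → plane i j u ≡ plane i j v
  πᵢ-≡⇒plane-≡ eq = lookup-≡⇒plane-≡ u v λ k≢i _ → π-≡⇒lookup-≡ i u v eq k≢i

  πⱼ-≡⇒plane-≡ : π j u ≡ π j v → plane i j u ≡ plane i j v
  πⱼ-≡⇒plane-≡ eq = lookup-≡⇒plane-≡ u v λ _ k≢j → π-≡⇒lookup-≡ j u v eq k≢j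

module Compression {m : ℕ} (A : List (Point (suc m))) (i j : Fin (suc m)) where

  line : Point m → List (Point (suc m))
  line w = filter (λ y → π i y ≟ᵥ w) (deduplicate _≟ᵥ_ A)

  inPlane : Point (suc m) → List (Point (suc m))
  inPlane p = filter (λ y → plane i j y ≟ᵥ p) (deduplicate _≟ᵥ_ A)

  widest : Point (suc m) → Point (suc m)
  widest p = argmax (fibreCount A i) p (inPlane p)

  longestLine : Point (suc m) → List (Point (suc m))
  longestLine p = line (π i (widest p))

  pickIn : Point (suc m) → Point (suc m) → Point (suc m)
  pickIn p x = nthOr x (longestLine p) (lookup x i)

  pick : Point (suc m) → Point (suc m)
  pick x = pickIn (plane i j x) x

  ∈-line⁻ : ∀ {y w} → y ∈ line w → y ∈ A × π i y ≡ w
  ∈-line⁻ {w = w} y∈ =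
    let y∈D , πy≡w = ∈-filter⁻ (λ y → π i y ≟ᵥ w) {xs = deduplicate _≟ᵥ_ A} y∈
    in ∈-deduplicate⁻ _≟ᵥ_ A y∈D , πy≡w

  ∈-inPlane⁺ : ∀ {y p} → y ∈ A → plane i j y ≡ p → y ∈ inPlane p
  ∈-inPlane⁺ {p = p} y∈A = ∈-filter⁺ (λ y → plane i j y ≟ᵥ p) (∈-deduplicate⁺ _≟ᵥ_ y∈A)

  ∈-inPlane⁻ : ∀ {y p} → y ∈ inPlane p → plane i j y ≡ p
  ∈-inPlane⁻ {p = p} y∈ = proj₂ (∈-filter⁻ (λ y → plane i j y ≟ᵥ p) {xs = deduplicate _≟ᵥ_ A} y∈)

  plane-widest : ∀ p → plane i j p ≡ p → plane i j (widest p) ≡ p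
  plane-widest p plane-p =
    argmax-all (fibreCount A i) {P = λ y → plane i j y ≡ p} plane-p (All.tabulate ∈-inPlane⁻)

  <-length-longestLine : ∀ {x} → InC i A x → lookup x i < length (longestLine (plane i j x))
  <-length-longestLine {x} x∈C with ∈-of-nonempty (≤-trans (s≤s z≤n) x∈C)
  ... | e , e∈line = ≤-trans x∈C (begin
    fibreCount A i x                      ≡⟨ cong (length ∘ line) (sym πe≡πx) ⟩
    fibreCount A i e                      ≤⟨ All.lookup (f[xs]≤f[argmax] {f = fibreCount A i} _ _) e∈plane ⟩
    fibreCount A i (widest (plane i j x)) ∎)
    where
    open ≤-Reasoning
    πe≡πx = proj₂ (∈-line⁻ e∈line)
    e∈plane = ∈-inPlane⁺ (proj₁ (∈-line⁻ e∈line)) (πᵢ-≡⇒plane-≡ e x πe≡πx)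

  module _ {x} (x∈C : InC i A x) where

    pick-∈-longestLine : pick x ∈ longestLine (plane i j x)
    pick-∈-longestLine = nthOr-∈ x _ (<-length-longestLine x∈C)

    pick-∈ : pick x ∈ A
    pick-∈ = proj₁ (∈-line⁻ pick-∈-longestLine)

    πᵢ-pick : π i (pick x) ≡ π i (widest (plane i j x))
    πᵢ-pick = proj₂ (∈-line⁻ pick-∈-longestLine)

    plane-pick : plane i j (pick x) ≡ plane i j x
    plane-pick = trans (πᵢ-≡⇒plane-≡ _ _ πᵢ-pick) (plane-widest (plane i j x) (plane-idem x))

  πⱼ-pick-≡⇒πⱼ-≡ : ∀ {x y} → InC i A x → InC i A y → π j (pick x) ≡ π j (pick y) → π j x ≡ π j y
  πⱼ-pick-≡⇒πⱼ-≡ {x} {y} x∈C y∈C πⱼ-eq = lookup-≡⇒π-≡ j x y agree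
    where
    same-plane : plane i j x ≡ plane i j y
    same-plane = trans (sym (plane-pick x∈C)) (trans (πⱼ-≡⇒plane-≡ _ _ πⱼ-eq) (plane-pick y∈C))

    lookup-i-≡ : i ≢ j → lookup x i ≡ lookup y i
    lookup-i-≡ i≢j = nthOr-injective (filter⁺ _ (deduplicate-! _≟ᵥ_ A))
      (<-length-longestLine x∈C) y-in-range pick-x≡pick-y
      where
      y-in-range = subst (λ p → lookup y i < length (longestLine p)) (sym same-plane) (<-length-longestLine y∈C)
      πᵢ-eq : π i (pick x) ≡ π i (pick y)
      πᵢ-eq = trans (πᵢ-pick x∈C) (trans (cong (π i ∘ widest) same-plane) (sym (πᵢ-pick y∈C)))
      pick-x≡pick-y : pick x ≡ pickIn (plane i j x) y
      pick-x≡pick-y = trans (π-≡∧π-≡⇒≡ _ _ i≢j πᵢ-eq πⱼ-eq) (cong (λ p → pickIn p y) (sym same-plane))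

    agree : ∀ {k} → k ≢ j → lookup x k ≡ lookup y k
    agree {k} k≢j with k ≟ᶠ i
    ... | yes refl = lookup-i-≡ k≢j
    ... | no k≢i   = plane-≡⇒lookup-≡ x y same-plane k≢i k≢j

lemma9 : (m : ℕ) (A : List (Point (suc m))) → All InX A →
    (i j : Fin (suc m)) →
    (CA : List (Point (suc m))) → (∀ x → (x ∈ CA) ⇔ InC i A x) →
    card (map (π j) CA) ≤ card (map (π j) A)
lemma9 m A _ i j CA CA⇔ = begin
  card (map (π j) CA)          ≤⟨ card-map-coarsen (π j) (π j ∘ pick) CA
                                    (λ x∈ y∈ → πⱼ-pick-≡⇒πⱼ-≡ (inC x∈) (inC y∈)) ⟩
  card (map (π j ∘ pick) CA)   ≤⟨ card-mono image-⊆ ⟩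
  card (map (π j) A)           ∎
  where
  open ≤-Reasoning
  open Compression A i j
  inC : ∀ {x} → x ∈ CA → InC i A x
  inC {x} = Equivalence.to (CA⇔ x)
  image-⊆ : map (π j ∘ pick) CA ⊆ map (π j) A
  image-⊆ z∈ with ∈-map⁻ (π j ∘ pick) z∈
  ... | x , x∈ , refl = ∈-map⁺ (π j) (pick-∈ (inC x∈))
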